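{- For every $k\ge 1$ and every non-constant Boolean function $f:\{0,1\}^n\to\{0,1\}$, $$\mathrm{Depth}(f)^{k-1}(\mathrm{Rank}(f)-1)+1\le \mathrm{Rank}(f^{\otimes k})\le \mathrm{Depth}(f)^{k-1}\,\mathrm{Rank}(f).$$
   Context: $\mathrm{Depth}(f)$ is the minimum depth of a decision tree (single-variable queries, $0/1$ leaves) computing $f$. The rank of a rooted binary tree: leaves have rank $0$; an internal node with children of ranks $a,b$ has rank $a+1$ if $a=b$, else $\max\{a,b\}$; $\mathrm{Rank}(f)$ is the minimum rank of a decision tree computing $f$. For $f:\{0,1\}^n\to\{0,1\}$ and $g:\{0,1\}^m\to\{0,1\}$, $f\circ g:\{0,1\}^{nm}\to\{0,1\}$ is $(a^1,\dots,a^n)\mapsto f(g(a^1),\dots,g(a^n))$. The iterated composition is $f^{\otimes 1}=f$, $f^{\otimes k}=f\circ f^{\otimes(k-1)}$, a function on $n^k$ variables. -}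

module Defs where

open import Data.Nat using (ℕ; zero; suc; _+_; _*_; _^_; _≤_; _⊔_)
open import Data.Bool using (Bool; true; false; if_then_else_)
open import Data.Fin using (Fin; combine)
open import Data.Product using (Σ; ∃; _×_; _,_)
open import Relation.Binary.PropositionalEquality using (_≡_)
open import Relation.Nullary using (¬_)

BoolFun : ℕ → Set
BoolFun n = (Fin n → Bool) → Bool

data DTree (n : ℕ) : Set where
  leaf : Bool → DTree n
  node : Fin n → DTree n → DTree n → DTree n   -- node i t₀ t₁ : go to t₀ if x i = 0, t₁ if x i = 1

eval : ∀ {n} → DTree n → (Fin n → Bool) → Bool
eval (leaf b) x = b
eval (node i t₀ t₁) x = if x i then eval t₁ x else eval t₀ x

depth : ∀ {n} → DTree n → ℕ
depth (leaf _) = 0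
depth (node _ t₀ t₁) = suc (depth t₀ ⊔ depth t₁)

rankCombine : ℕ → ℕ → ℕ
rankCombine zero zero = 1
rankCombine zero (suc b) = suc b
rankCombine (suc a) zero = suc a
rankCombine (suc a) (suc b) = suc (rankCombine a b)
-- rankCombine a b = a + 1 if a = b, else max a b

rank : ∀ {n} → DTree n → ℕ
rank (leaf _) = 0
rank (node _ t₀ t₁) = rankCombine (rank t₀) (rank t₁)

Computes : ∀ {n} → DTree n → BoolFun n → Set
Computes t f = ∀ x → eval t x ≡ f x

IsDepth : ∀ {n} → BoolFun n → ℕ → Set
IsDepth {n} f d =
  (Σ (DTree n) λ t → Computes t f × depth t ≡ d) ×
  (∀ (t : DTree n) → Computes t f → d ≤ depth t)

IsRank : ∀ {n} → BoolFun n → ℕ → Set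
IsRank {n} f r =
  (Σ (DTree n) λ t → Computes t f × rank t ≡ r) ×
  (∀ (t : DTree n) → Computes t f → r ≤ rank t)

compose : ∀ {n m} → BoolFun n → BoolFun m → BoolFun (n * m)
compose {n} {m} f g a = f (λ i → g (λ j → a (combine i j)))

-- Thus for k ≥ 1, iter f k = f^{⊗k}  (iter f 1 = f ∘ id, which is f with
-- its variables indexed via combine i zero).
iter : ∀ {n} → BoolFun n → (k : ℕ) → BoolFun (n ^ k)
iter f zero a = a Fin.zero
  where import Data.Fin as Fin
iter f (suc k) = compose f (iter f k)

NonConstant : ∀ {n} → BoolFun n → Set
NonConstant f = ∃ λ x → ∃ λ y → ¬ (f x ≡ f y)

-- Upper bound: substituting a rank-optimal tree for the inner function at every node of a
-- depth-optimal tree for f costs a factor depth(f) in rank, so Rank(f ∘ g) ≤ Depth(f) · Rank(g).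
-- Lower bound: Rank(f ∘ g) ≥ Depth(f) · (Rank(g) − 1) + 1.  Against any tree for f ∘ g an adversary
-- answers queries inside each block so that g keeps as much rank as possible on the inputs still
-- allowed there, collecting a point whenever both answers would lower it.  After c = Rank(g) − 1
-- points the block splits into two halves on which g is constant, and the value of g on the block
-- is handed to a depth adversary for f.  The invariant is  D · c + 1 ≤ rank of the remaining tree +
-- points of the unfixed blocks,  where f still needs depth D; iterating both bounds gives f^{⊗k}.
module Submission where

open import Defs
open import Level using (0ℓ)
open import Data.Nat using (ℕ; zero; suc; _+_; _*_; _∸_; _^_; _≤_; _<_; _⊔_; _⊓_; z≤n; s≤s; _≤?_)
open import Data.Nat.Properties
open import Data.Bool using (Bool; true; false; if_then_else_; not) renaming (_≟_ to _≟ᵇ_)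
open import Data.Bool.Properties using (¬-not; not-¬; not-involutive)
open import Data.Fin using (Fin; combine; remQuot)
  renaming (zero to fzero; suc to fsuc; _≟_ to _≟ᶠ_)
open import Data.Fin.Properties using (remQuot-combine; combine-remQuot)
  renaming (suc-injective to fsuc-injective)
open import Data.Vec.Functional using (Vector; updateAt)
open import Data.Vec.Functional.Properties using (updateAt-updates; updateAt-minimal)
open import Algebra.Properties.Monoid.Sum +-0-monoid using (sum; sum-cong-≗; sum-replicate-zero)
open import Data.Product using (∃-syntax; _×_; _,_; proj₁; proj₂; uncurry)
open import Data.Unit using (⊤; tt)
open import Data.Empty using (⊥-elim)
open import Function using (_∘_)
open import Effect.Monad using (RawMonad)
open import Relation.Binary.Core using (_Preserves_⟶_)
open import Relation.Binary.Definitions using (_Respects_)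
open import Relation.Binary.PropositionalEquality
open import Relation.Nullary using (¬_; Dec; yes; no)
open import Relation.Nullary.Decidable using (decidable-stable; ¬¬-excluded-middle)
open import Relation.Nullary.Negation using (¬¬-Monad; contradiction)
open import Relation.Unary using (Pred; U; Satisfiable; _∩_; _⊆_; _⊆′_)

-- Lower bounds relative to a set of inputs quantify over all trees and are not decidable, so the
-- adversary's case analyses run in the double-negation monad; its conclusions are decidable.
open RawMonad (¬¬-Monad {0ℓ}) using (pure; _>>=_)

rankCombine-comm : ∀ a b → rankCombine a b ≡ rankCombine b a
rankCombine-comm zero    zero    = refl
rankCombine-comm zero    (suc b) = refl
rankCombine-comm (suc a) zero    = refl
rankCombine-comm (suc a) (suc b) = cong suc (rankCombine-comm a b)

rankCombine-positive : ∀ a b → 0 < rankCombine a b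
rankCombine-positive zero    zero    = s≤s z≤n
rankCombine-positive zero    (suc b) = s≤s z≤n
rankCombine-positive (suc a) zero    = s≤s z≤n
rankCombine-positive (suc a) (suc b) = s≤s z≤n

rankCombine-≥ˡ : ∀ a b → a ≤ rankCombine a b
rankCombine-≥ˡ zero    b       = z≤n
rankCombine-≥ˡ (suc a) zero    = ≤-refl
rankCombine-≥ˡ (suc a) (suc b) = s≤s (rankCombine-≥ˡ a b)

rankCombine-≥ʳ : ∀ a b → b ≤ rankCombine a b
rankCombine-≥ʳ a b = subst (b ≤_) (rankCombine-comm b a) (rankCombine-≥ˡ b a)

rankCombine-≥-1+⊓ : ∀ a b → suc (a ⊓ b) ≤ rankCombine a b
rankCombine-≥-1+⊓ zero    zero    = ≤-refl
rankCombine-≥-1+⊓ zero    (suc b) = s≤s z≤n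
rankCombine-≥-1+⊓ (suc a) zero    = s≤s z≤n
rankCombine-≥-1+⊓ (suc a) (suc b) = s≤s (rankCombine-≥-1+⊓ a b)

rankCombine-mono-≤ : ∀ {a a′ b b′} → a ≤ a′ → b ≤ b′ → rankCombine a b ≤ rankCombine a′ b′
rankCombine-mono-≤ {zero}  {a′} {zero}  {b′} _    _    = rankCombine-positive a′ b′
rankCombine-mono-≤ {zero}  {a′} {suc b} {b′} _    b≤b′ = ≤-trans b≤b′ (rankCombine-≥ʳ a′ b′)
rankCombine-mono-≤ {suc a} {a′} {zero}  {b′} a≤a′ _    = ≤-trans a≤a′ (rankCombine-≥ˡ a′ b′)
rankCombine-mono-≤ {suc a} {suc a′} {suc b} {suc b′} (s≤s a≤a′) (s≤s b≤b′) =
  s≤s (rankCombine-mono-≤ a≤a′ b≤b′)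

+-rankCombine : ∀ k a b → rankCombine (k + a) (k + b) ≡ k + rankCombine a b
+-rankCombine zero    a b = refl
+-rankCombine (suc k) a b = cong suc (+-rankCombine k a b)

rankCombine-≤ : ∀ {a b x} → a ≤ x → b < x → rankCombine a b ≤ x
rankCombine-≤ {zero}  {zero}  _         (s≤s _)   = s≤s z≤n
rankCombine-≤ {zero}  {suc b} _         b<x       = <⇒≤ b<x
rankCombine-≤ {suc a} {zero}  a≤x       _         = a≤x
rankCombine-≤ {suc a} {suc b} (s≤s a≤x) (s≤s b<x) = s≤s (rankCombine-≤ a≤x b<x)

rankCombine-≤′ : ∀ {a b x} → a < x → b ≤ x → rankCombine a b ≤ x
rankCombine-≤′ {a} {b} a<x b≤x = subst (_≤ _) (rankCombine-comm b a) (rankCombine-≤ b≤x a<x)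

Input : ℕ → Set
Input k = Fin k → Bool

eval-cong : ∀ {k} (t : DTree k) {x y : Input k} → x ≗ y → eval t x ≡ eval t y
eval-cong (leaf b)       x≗y = refl
eval-cong (node i t₀ t₁) x≗y rewrite x≗y i | eval-cong t₀ x≗y | eval-cong t₁ x≗y = refl

Extensional : ∀ {k} → BoolFun k → Set
Extensional f = f Preserves _≗_ ⟶ _≡_

computes⇒extensional : ∀ {k} {f : BoolFun k} (t : DTree k) → Computes t f → Extensional f
computes⇒extensional t ok {x} {y} x≗y = trans (sym (ok x)) (trans (eval-cong t x≗y) (ok y))

iter-extensional : ∀ {n} {f : BoolFun n} → Extensional f → ∀ k → Extensional (iter f k)
iter-extensional f-ext zero    x≗y = x≗y fzero
iter-extensional f-ext (suc k) x≗y = f-ext λ i → iter-extensional f-ext k λ j → x≗y (combine i j)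

nonConstant⇒¬leaf : ∀ {k} {f : BoolFun k} {b} → NonConstant f → ¬ Computes (leaf b) f
nonConstant⇒¬leaf (x , y , fx≢fy) ok = fx≢fy (trans (sym (ok x)) (ok y))

nonConstant⇒depth-positive : ∀ {k} {f : BoolFun k} → NonConstant f → ∀ t → Computes t f → 0 < depth t
nonConstant⇒depth-positive nc (leaf _)     ok = ⊥-elim (nonConstant⇒¬leaf nc ok)
nonConstant⇒depth-positive _  (node _ _ _) _  = s≤s z≤n

nonConstant⇒rank-positive : ∀ {k} {f : BoolFun k} → NonConstant f → ∀ t → Computes t f → 0 < rank t
nonConstant⇒rank-positive nc (leaf _)       ok = ⊥-elim (nonConstant⇒¬leaf nc ok)
nonConstant⇒rank-positive _  (node _ t₀ t₁) _  = rankCombine-positive (rank t₀) (rank t₁)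

relabel : ∀ {k l} → (Fin k → Fin l) → DTree k → DTree l
relabel p (leaf b)       = leaf b
relabel p (node i t₀ t₁) = node (p i) (relabel p t₀) (relabel p t₁)

eval-relabel : ∀ {k l} (p : Fin k → Fin l) t x → eval (relabel p t) x ≡ eval t (x ∘ p)
eval-relabel p (leaf b)       x = refl
eval-relabel p (node i t₀ t₁) x rewrite eval-relabel p t₀ x | eval-relabel p t₁ x = refl

rank-relabel : ∀ {k l} (p : Fin k → Fin l) t → rank (relabel p t) ≡ rank t
rank-relabel p (leaf b)       = refl
rank-relabel p (node i t₀ t₁) = cong₂ rankCombine (rank-relabel p t₀) (rank-relabel p t₁)

part : ∀ {n m} → Input (n * m) → Fin n → Input m
part a i j = a (combine i j)

glue : ∀ {n m} → (Fin n → Input m) → Input (n * m)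
glue {n} {m} ws v = uncurry ws (remQuot {n} m v)

part-glue : ∀ {n m} (ws : Fin n → Input m) i → part (glue ws) i ≗ ws i
part-glue ws i j = cong (uncurry ws) (remQuot-combine i j)

graft : ∀ {n m} → Fin n → DTree m → DTree (n * m) → DTree (n * m) → DTree (n * m)
graft i (leaf false)   t₀ t₁ = t₀
graft i (leaf true)    t₀ t₁ = t₁
graft i (node j u₀ u₁) t₀ t₁ = node (combine i j) (graft i u₀ t₀ t₁) (graft i u₁ t₀ t₁)

substitute : ∀ {n m} → DTree m → DTree n → DTree (n * m)
substitute u (leaf b)       = leaf b
substitute u (node i t₀ t₁) = graft i u (substitute u t₀) (substitute u t₁)

eval-graft : ∀ {n m} (i : Fin n) (u : DTree m) (t₀ t₁ : DTree (n * m)) a →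
  eval (graft i u t₀ t₁) a ≡ (if eval u (part a i) then eval t₁ a else eval t₀ a)
eval-graft i (leaf false)   t₀ t₁ a = refl
eval-graft i (leaf true)    t₀ t₁ a = refl
eval-graft i (node j u₀ u₁) t₀ t₁ a with a (combine i j)
... | false = eval-graft i u₀ t₀ t₁ a
... | true  = eval-graft i u₁ t₀ t₁ a

eval-substitute : ∀ {n m} (u : DTree m) (t : DTree n) a →
  eval (substitute u t) a ≡ eval t (λ i → eval u (part a i))
eval-substitute u (leaf b) a = refl
eval-substitute u (node i t₀ t₁) a
  rewrite eval-graft i u (substitute u t₀) (substitute u t₁) a with eval u (part a i)
... | false = eval-substitute u t₀ a
... | true  = eval-substitute u t₁ a

computes-substitute : ∀ {n m} {f : BoolFun n} {g : BoolFun m} (t : DTree n) (u : DTree m) →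
  Computes t f → Computes u g → Computes (substitute u t) (compose f g)
computes-substitute {f = f} {g} t u okₜ okᵤ a = begin
  eval (substitute u t) a           ≡⟨ eval-substitute u t a ⟩
  eval t (λ i → eval u (part a i))  ≡⟨ eval-cong t (λ i → okᵤ (part a i)) ⟩
  eval t (λ i → g (part a i))       ≡⟨ okₜ _ ⟩
  compose f g a                     ∎
  where open ≡-Reasoning

rank-graft : ∀ {n m} (i : Fin n) (u : DTree m) (t₀ t₁ : DTree (n * m)) →
  rank (graft i u t₀ t₁) ≤ (rank t₀ ⊔ rank t₁) + rank u
rank-graft i (leaf false)   t₀ t₁ = ≤-trans (m≤m⊔n (rank t₀) (rank t₁)) (m≤m+n _ 0)
rank-graft i (leaf true)    t₀ t₁ = ≤-trans (m≤n⊔m (rank t₀) (rank t₁)) (m≤m+n _ 0)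
rank-graft i (node j u₀ u₁) t₀ t₁ = begin
  rankCombine (rank (graft i u₀ t₀ t₁)) (rank (graft i u₁ t₀ t₁))
    ≤⟨ rankCombine-mono-≤ (rank-graft i u₀ t₀ t₁) (rank-graft i u₁ t₀ t₁) ⟩
  rankCombine (M + rank u₀) (M + rank u₁)  ≡⟨ +-rankCombine M (rank u₀) (rank u₁) ⟩
  M + rankCombine (rank u₀) (rank u₁)      ∎
  where
    open ≤-Reasoning
    M = rank t₀ ⊔ rank t₁

rank-substitute : ∀ {n m} (u : DTree m) (t : DTree n) → rank (substitute u t) ≤ depth t * rank u
rank-substitute u (leaf b)       = z≤n
rank-substitute u (node i t₀ t₁) = begin
  rank (graft i u (substitute u t₀) (substitute u t₁))
    ≤⟨ rank-graft i u (substitute u t₀) (substitute u t₁) ⟩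
  (rank (substitute u t₀) ⊔ rank (substitute u t₁)) + rank u
    ≤⟨ +-monoˡ-≤ (rank u) (⊔-mono-≤ (rank-substitute u t₀) (rank-substitute u t₁)) ⟩
  (depth t₀ * rank u ⊔ depth t₁ * rank u) + rank u
    ≡⟨ cong (_+ rank u) (*-distribʳ-⊔ (rank u) (depth t₀) (depth t₁)) ⟨
  (depth t₀ ⊔ depth t₁) * rank u + rank u
    ≡⟨ +-comm _ (rank u) ⟩
  suc (depth t₀ ⊔ depth t₁) * rank u ∎
  where open ≤-Reasoning

iter-rank-≤ : ∀ {n} {f : BoolFun n} (tᵈ tʳ : DTree n) → Computes tᵈ f → Computes tʳ f →
  ∀ k → ∃[ t ] Computes t (iter f (suc k)) × rank t ≤ depth tᵈ ^ k * rank tʳ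
iter-rank-≤ _ tʳ _ okʳ zero =
  relabel (λ i → combine i fzero) tʳ ,
  (λ a → trans (eval-relabel _ tʳ a) (okʳ _)) ,
  ≤-reflexive (trans (rank-relabel _ tʳ) (sym (*-identityˡ (rank tʳ))))
iter-rank-≤ tᵈ tʳ okᵈ okʳ (suc k) with iter-rank-≤ tᵈ tʳ okᵈ okʳ k
... | t , ok , t≤ = substitute t tᵈ , computes-substitute tᵈ t okᵈ ok , (begin
  rank (substitute t tᵈ)              ≤⟨ rank-substitute t tᵈ ⟩
  depth tᵈ * rank t                   ≤⟨ *-monoʳ-≤ (depth tᵈ) t≤ ⟩
  depth tᵈ * (depth tᵈ ^ k * rank tʳ) ≡⟨ *-assoc (depth tᵈ) _ (rank tʳ) ⟨
  depth tᵈ ^ suc k * rank tʳ          ∎)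
  where open ≤-Reasoning

¬¬-Π-Fin : ∀ {n} {A : Fin n → Set} → (∀ i → ¬ ¬ A i) → ¬ ¬ (∀ i → A i)
¬¬-Π-Fin {zero}  _ ¬a = ¬a λ ()
¬¬-Π-Fin {suc n} a = do
  a₀ ← a fzero
  aₛ ← ¬¬-Π-Fin (a ∘ fsuc)
  pure λ { fzero → a₀ ; (fsuc i) → aₛ i }

xᵢ≤sum : ∀ {k} (v : Vector ℕ k) i → v i ≤ sum v
xᵢ≤sum v fzero    = m≤m+n (v fzero) _
xᵢ≤sum v (fsuc i) = ≤-trans (xᵢ≤sum (v ∘ fsuc) i) (m≤n+m _ (v fzero))

sum-agree-except : ∀ {k} (v w : Vector ℕ k) i → (∀ i′ → i′ ≢ i → v i′ ≡ w i′) →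
  sum v + w i ≡ sum w + v i
sum-agree-except v w fzero v≗w = begin
  v fzero + sum (v ∘ fsuc) + w fzero  ≡⟨ cong (λ s → v fzero + s + w fzero) (sum-cong-≗ tails) ⟩
  v fzero + S + w fzero               ≡⟨ +-assoc (v fzero) S (w fzero) ⟩
  v fzero + (S + w fzero)             ≡⟨ +-comm (v fzero) _ ⟩
  S + w fzero + v fzero               ≡⟨ cong (_+ v fzero) (+-comm S (w fzero)) ⟩
  w fzero + S + v fzero               ∎
  where
    open ≡-Reasoning
    S = sum (w ∘ fsuc)
    tails : v ∘ fsuc ≗ w ∘ fsuc
    tails i = v≗w (fsuc i) λ ()
sum-agree-except v w (fsuc i) v≗w = begin
  v fzero + sum (v ∘ fsuc) + w (fsuc i)    ≡⟨ +-assoc (v fzero) _ _ ⟩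
  v fzero + (sum (v ∘ fsuc) + w (fsuc i))  ≡⟨ cong₂ _+_ (v≗w fzero λ ()) (sum-agree-except _ _ i tails) ⟩
  w fzero + (sum (w ∘ fsuc) + v (fsuc i))  ≡⟨ +-assoc (w fzero) _ _ ⟨
  w fzero + sum (w ∘ fsuc) + v (fsuc i)    ∎
  where
    open ≡-Reasoning
    tails : ∀ i′ → i′ ≢ i → v (fsuc i′) ≡ w (fsuc i′)
    tails i′ i′≢i = v≗w (fsuc i′) (i′≢i ∘ fsuc-injective)

record ComputesOn {k} (t : DTree k) (h : BoolFun k) (P : Pred (Input k) 0ℓ) : Set where
  constructor computesOn
  field agrees : ∀ x → P x → eval t x ≡ h x

open ComputesOn

AtLeast : ∀ {k} → (DTree k → ℕ) → BoolFun k → Pred (Input k) 0ℓ → ℕ → Set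
AtLeast cost h P q = ∀ t → ComputesOn t h P → q ≤ cost t

RankAtLeast DepthAtLeast : ∀ {k} → BoolFun k → Pred (Input k) 0ℓ → ℕ → Set
RankAtLeast  = AtLeast rank
DepthAtLeast = AtLeast depth

restrict : ∀ {k} → Pred (Input k) 0ℓ → Fin k → Bool → Pred (Input k) 0ℓ
restrict P j b = P ∩ λ x → x j ≡ b

restrict-respects : ∀ {k} {P : Pred (Input k) 0ℓ} {j b} → P Respects _≗_ → restrict P j b Respects _≗_
restrict-respects resp x≗y (px , xj≡b) = resp x≗y px , trans (sym (x≗y _)) xj≡b

computesOn-mono : ∀ {k} {t : DTree k} {h P Q} → P ⊆′ Q → ComputesOn t h Q → ComputesOn t h P
computesOn-mono P⊆Q ok = computesOn λ x px → agrees ok x (P⊆Q x px)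

atLeast-mono : ∀ {k} {cost : DTree k → ℕ} {h P Q q} → P ⊆′ Q → AtLeast cost h P q → AtLeast cost h Q q
atLeast-mono P⊆Q lb t ok = lb t (computesOn-mono P⊆Q ok)

¬atLeast⇒¬¬tree : ∀ {k} {cost : DTree k → ℕ} {h P q} →
  ¬ AtLeast cost h P q → ¬ ¬ (∃[ t ] ComputesOn t h P × cost t < q)
¬atLeast⇒¬¬tree ¬lb ¬t = ¬lb λ t ok → ≮⇒≥ λ t<q → ¬t (t , ok , t<q)

computesOn-split : ∀ {k} {t : DTree k} {h P} j →
  ComputesOn t h (restrict P j false) → ComputesOn t h (restrict P j true) → ComputesOn t h P
computesOn-split {t = t} {h} {P} j ok₀ ok₁ = computesOn split
  where
    split : ∀ x → P x → eval t x ≡ h x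
    split x px with x j in xj
    ... | false = agrees ok₀ x (px , xj)
    ... | true  = agrees ok₁ x (px , xj)

branch : ∀ {k} → Bool → DTree k → DTree k → DTree k
branch false t₀ t₁ = t₀
branch true  t₀ t₁ = t₁

rank-branch : ∀ {k} b (t₀ t₁ : DTree k) → rank (branch b t₀ t₁) ≤ rankCombine (rank t₀) (rank t₁)
rank-branch false t₀ t₁ = rankCombine-≥ˡ (rank t₀) (rank t₁)
rank-branch true  t₀ t₁ = rankCombine-≥ʳ (rank t₀) (rank t₁)

eval-node : ∀ {k} {j : Fin k} (t₀ t₁ : DTree k) x {b} →
  x j ≡ b → eval (node j t₀ t₁) x ≡ eval (branch b t₀ t₁) x
eval-node t₀ t₁ x {false} xj≡b = cong (λ c → if c then eval t₁ x else eval t₀ x) xj≡b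
eval-node t₀ t₁ x {true}  xj≡b = cong (λ c → if c then eval t₁ x else eval t₀ x) xj≡b

computesOn-branch : ∀ {k} {j : Fin k} {t₀ t₁ h P} b →
  ComputesOn (node j t₀ t₁) h P → ComputesOn (branch b t₀ t₁) h (restrict P j b)
computesOn-branch {t₀ = t₀} {t₁} b ok =
  computesOn λ x (px , xj≡b) → trans (sym (eval-node t₀ t₁ x xj≡b)) (agrees ok x px)

computesOn-node : ∀ {k} {j : Fin k} {t₀ t₁ h P} →
  ComputesOn t₀ h (restrict P j false) → ComputesOn t₁ h (restrict P j true) →
  ComputesOn (node j t₀ t₁) h P
computesOn-node {j = j} {t₀} {t₁} ok₀ ok₁ = computesOn-split j
  (computesOn λ x (px , xj≡b) → trans (eval-node t₀ t₁ x xj≡b) (agrees ok₀ x (px , xj≡b)))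
  (computesOn λ x (px , xj≡b) → trans (eval-node t₀ t₁ x xj≡b) (agrees ok₁ x (px , xj≡b)))

depthAtLeast-query : ∀ {k} {h : BoolFun k} {Q D} → DepthAtLeast h Q (suc D) →
  ∀ i → ¬ ¬ (∃[ b ] DepthAtLeast h (restrict Q i b) D)
depthAtLeast-query lb i ¬b =
  ¬atLeast⇒¬¬tree (λ lb₀ → ¬b (false , lb₀)) λ (t₀ , ok₀ , t₀<D) →
  ¬atLeast⇒¬¬tree (λ lb₁ → ¬b (true , lb₁))  λ (t₁ , ok₁ , t₁<D) →
  <⇒≱ (s≤s (⊔-lub t₀<D t₁<D)) (lb (node i t₀ t₁) (computesOn-node ok₀ ok₁))

-- Otherwise a tree of rank < q on this half and one of rank ≤ q on the other would combine into
-- a tree of rank ≤ q on all of P.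
rankAtLeast-restrict : ∀ {k} {h : BoolFun k} {P q} j b → RankAtLeast h P (suc q) →
  ¬ RankAtLeast h (restrict P j (not b)) (suc q) → RankAtLeast h (restrict P j b) q
rankAtLeast-restrict {q = q} j false lb ¬lb t ok = decidable-stable (q ≤? rank t) λ q≰t →
  ¬atLeast⇒¬¬tree ¬lb λ (t′ , ok′ , t′<) →
  <⇒≱ (lb (node j t t′) (computesOn-node ok ok′)) (rankCombine-≤′ (≰⇒> q≰t) (≤-pred t′<))
rankAtLeast-restrict {q = q} j true lb ¬lb t ok = decidable-stable (q ≤? rank t) λ q≰t →
  ¬atLeast⇒¬¬tree ¬lb λ (t′ , ok′ , t′<) →
  <⇒≱ (lb (node j t′ t) (computesOn-node ok′ ok)) (rankCombine-≤ (≤-pred t′<) (≰⇒> q≰t))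

¬rankAtLeast-1⇒¬¬constant : ∀ {k} {h : BoolFun k} {P} →
  ¬ RankAtLeast h P 1 → ¬ ¬ (∃[ b ] ComputesOn (leaf b) h P)
¬rankAtLeast-1⇒¬¬constant {h = h} {P} ¬lb = do
    (t , ok , t<1) ← ¬atLeast⇒¬¬tree ¬lb
    pure (leafOf t ok t<1)
  where
    leafOf : ∀ t → ComputesOn t h P → rank t < 1 → ∃[ b ] ComputesOn (leaf b) h P
    leafOf (leaf b)       ok _   = b , ok
    leafOf (node _ t₀ t₁) _  r<1 = ⊥-elim (<⇒≱ r<1 (rankCombine-positive (rank t₀) (rank t₁)))

rankAtLeast⇒¬¬attains : ∀ {k} {h : BoolFun k} {P q} → RankAtLeast h P (suc q) →
  ∀ b → ¬ ¬ (∃[ x ] P x × h x ≡ b)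
rankAtLeast⇒¬¬attains lb b ¬x =
  n≮0 (lb (leaf (not b)) (computesOn λ x px → sym (¬-not λ hx≡b → ¬x (x , px , hx≡b))))

module Adversary {n m : ℕ} {f : BoolFun n} {g : BoolFun m}
                 (f-ext : Extensional f) (g-ext : Extensional g) (c : ℕ) where

  data State : Set where
    live  : (spent left : ℕ) → State
    fixed : Bool → State

  points : State → ℕ
  points (live spent _) = spent
  points (fixed _)      = 0

  Allows : State → Pred Bool 0ℓ
  Allows (live _ _) _  = ⊤
  Allows (fixed b)  b′ = b′ ≡ b

  Valid : Pred (Input m) 0ℓ → State → Set
  Valid P (live spent left) = spent + left ≡ c × RankAtLeast g P (suc left)
  Valid P (fixed b)         = ComputesOn (leaf b) g P × Satisfiable P

  record Block : Set₁ where
    field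
      inputs   : Pred (Input m) 0ℓ
      respects : inputs Respects _≗_
      state    : State
      valid    : Valid inputs state

  open Block

  Position : Set₁
  Position = Vector Block n

  Consistent : Position → Pred (Input (n * m)) 0ℓ
  Consistent π a = ∀ i → inputs (π i) (part a i)

  Forced : Position → Pred (Input n) 0ℓ
  Forced π y = ∀ i → Allows (state (π i)) (y i)

  score : Position → ℕ
  score π = sum (points ∘ state ∘ π)

  -- Nothing is claimed when D = 0, as f may then be constant on the forced inputs.
  potential : ℕ → ℕ
  potential zero    = 0
  potential (suc D) = suc D * c + 1

  PotentialBound : DTree (n * m) → Set₁
  PotentialBound T = ∀ π D → DepthAtLeast f (Forced π) D →
    ComputesOn T (compose f g) (Consistent π) → potential D ≤ rank T + score π

  realise : ∀ {P} s {b} → Valid P s → Allows s b → ¬ ¬ (∃[ w ] P w × g w ≡ b)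
  realise (live _ _) {b} (_ , lb)         _    = rankAtLeast⇒¬¬attains lb b
  realise (fixed b)      (const , w , pw) refl = pure (w , pw , sym (agrees const w pw))

  forced⇒¬¬consistent : ∀ π {y} → Forced π y →
    ¬ ¬ (∃[ a ] Consistent π a × (λ i → g (part a i)) ≗ y)
  forced⇒¬¬consistent π fy = do
      ws ← ¬¬-Π-Fin λ i → realise (state (π i)) (valid (π i)) (fy i)
      let w = proj₁ ∘ ws
      pure (glue w ,
            (λ i → respects (π i) (sym ∘ part-glue w i) (proj₁ (proj₂ (ws i)))) ,
            (λ i → trans (g-ext (part-glue w i)) (proj₂ (proj₂ (ws i)))))

  leaf-bound : ∀ b → PotentialBound (leaf b)
  leaf-bound b π zero    _   _  = z≤n
  leaf-bound b π (suc D) dlb ok = ⊥-elim (n≮0 (dlb (leaf b) (computesOn leaf-forced)))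
    where
      leaf-forced : ∀ y → Forced π y → b ≡ f y
      leaf-forced y fy = decidable-stable (b ≟ᵇ f y) do
        (a , ca , ga≗y) ← forced⇒¬¬consistent π fy
        pure (trans (agrees ok a ca) (f-ext ga≗y))

  _[_]≔_ : Position → Fin n → Block → Position
  π [ i ]≔ B = updateAt π i λ _ → B

  consistent-update : ∀ π i B → inputs B ⊆ inputs (π i) →
    Consistent (π [ i ]≔ B) ⊆′ Consistent π ∩ λ a → inputs B (part a i)
  consistent-update π i B B⊆ a ca = old , new
    where
      new : inputs B (part a i)
      new = subst (λ B′ → inputs B′ (part a i)) (updateAt-updates i π) (ca i)
      old : Consistent π a
      old i′ with i′ ≟ᶠ i
      ... | yes refl = B⊆ new
      ... | no i′≢i  =
        subst (λ B′ → inputs B′ (part a i′)) (updateAt-minimal i′ i π i′≢i) (ca i′)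

  forced-update : ∀ π i B {y} → Forced π y → Allows (state B) (y i) → Forced (π [ i ]≔ B) y
  forced-update π i B {y} fy allowed i′ with i′ ≟ᶠ i
  ... | yes refl = subst (λ B′ → Allows (state B′) (y i′)) (sym (updateAt-updates i′ π)) allowed
  ... | no i′≢i  =
    subst (λ B′ → Allows (state B′) (y i′)) (sym (updateAt-minimal i′ i π i′≢i)) (fy i′)

  score-update : ∀ π i B → score (π [ i ]≔ B) + points (state (π i)) ≡ score π + points (state B)
  score-update π i B =
    trans (sum-agree-except _ _ i λ i′ i′≢i → cong (points ∘ state) (updateAt-minimal i′ i π i′≢i))
          (cong (λ B′ → score π + points (state B′)) (updateAt-updates i π))

  narrow : (B : Block) (j : Fin m) (b : Bool) (s : State) → Valid (restrict (inputs B) j b) s → Block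
  narrow B j b s v = record
    { inputs = restrict (inputs B) j b ; respects = restrict-respects (respects B) ; state = s ; valid = v }

  module NodeStep (i : Fin n) (j : Fin m) {T₀ T₁ : DTree (n * m)}
                  (ih : ∀ b → PotentialBound (branch b T₀ T₁)) (π : Position)
                  (ok : ComputesOn (node (combine i j) T₀ T₁) (compose f g) (Consistent π)) where

    P : Pred (Input m) 0ℓ
    P = inputs (π i)

    Half : Bool → Pred (Input m) 0ℓ
    Half = restrict P j

    r : ℕ
    r = rankCombine (rank T₀) (rank T₁)

    narrowed : ∀ b s → Valid (Half b) s → Position
    narrowed b s v = π [ i ]≔ narrow (π i) j b s v

    descend : ∀ b s (v : Valid (Half b) s) D → DepthAtLeast f (Forced (narrowed b s v)) D →
              potential D ≤ rank (branch b T₀ T₁) + score (narrowed b s v)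
    descend b s v D dlb =
      ih b (narrowed b s v) D dlb (computesOn-mono consistent⊆ (computesOn-branch b ok))
      where
        consistent⊆ : Consistent (narrowed b s v) ⊆′ restrict (Consistent π) (combine i j) b
        consistent⊆ a ca =
          let (cπ , _ , aᵢⱼ≡b) = consistent-update π i (narrow (π i) j b s v) proj₁ a ca
          in cπ , aᵢⱼ≡b

    keep : ∀ D → DepthAtLeast f (Forced π) D → ∀ b → Valid (Half b) (state (π i)) →
           potential D ≤ r + score π
    keep D dlb b v = begin
      potential D                       ≤⟨ descend b _ v D (atLeast-mono forced⊆ dlb) ⟩
      rank (branch b T₀ T₁) + score π′  ≡⟨ cong (rank (branch b T₀ T₁) +_) score-kept ⟩
      rank (branch b T₀ T₁) + score π   ≤⟨ +-monoˡ-≤ (score π) (rank-branch b T₀ T₁) ⟩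
      r + score π                       ∎
      where
        open ≤-Reasoning
        B = narrow (π i) j b (state (π i)) v
        π′ = π [ i ]≔ B
        forced⊆ : Forced π ⊆′ Forced π′
        forced⊆ _ fy = forced-update π i B fy (fy i)
        score-kept : score π′ ≡ score π
        score-kept = +-cancelʳ-≡ _ _ _ (score-update π i B)

    spend : ∀ D → DepthAtLeast f (Forced π) D → ∀ spent left → points (state (π i)) ≡ spent →
            (∀ b → Valid (Half b) (live (suc spent) left)) → potential D ≤ r + score π
    spend D dlb spent left pointsᵢ≡ v = begin
      potential D                                 ≤⟨ ⊓-glb (via false) (via true) ⟩
      (ρ₀ + suc (score π)) ⊓ (ρ₁ + suc (score π)) ≡⟨ +-distribʳ-⊓ (suc (score π)) ρ₀ ρ₁ ⟨
      (ρ₀ ⊓ ρ₁) + suc (score π)                   ≡⟨ +-suc (ρ₀ ⊓ ρ₁) (score π) ⟩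
      suc (ρ₀ ⊓ ρ₁) + score π                     ≤⟨ +-monoˡ-≤ (score π) (rankCombine-≥-1+⊓ ρ₀ ρ₁) ⟩
      r + score π                                 ∎
      where
        open ≤-Reasoning
        ρ₀ = rank T₀
        ρ₁ = rank T₁
        B : Bool → Block
        B b = narrow (π i) j b (live (suc spent) left) (v b)
        score-spent : ∀ b → score (π [ i ]≔ B b) ≡ suc (score π)
        score-spent b = +-cancelʳ-≡ spent _ _ (begin-equality
          score (π [ i ]≔ B b) + spent                 ≡⟨ cong (score (π [ i ]≔ B b) +_) pointsᵢ≡ ⟨
          score (π [ i ]≔ B b) + points (state (π i))  ≡⟨ score-update π i (B b) ⟩
          score π + suc spent                          ≡⟨ +-suc (score π) spent ⟩
          suc (score π) + spent                        ∎)
        via : ∀ b → potential D ≤ rank (branch b T₀ T₁) + suc (score π)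
        via b = subst (λ s → potential D ≤ rank (branch b T₀ T₁) + s) (score-spent b)
                  (descend b _ (v b) D (atLeast-mono (λ _ fy → forced-update π i (B b) fy tt) dlb))

    module Fix (pointsᵢ≡c : points (state (π i)) ≡ c) (lb : RankAtLeast g P 1) (c₀ : Bool)
               (const₀ : ComputesOn (leaf c₀) g (Half false))
               (const₁ : ComputesOn (leaf (not c₀)) g (Half true)) where

      value : Bool → Bool
      value b = if b then not c₀ else c₀

      value-not : ∀ b → value (not b) ≡ not (value b)
      value-not false = refl
      value-not true  = sym (not-involutive c₀)

      value-onto : ∀ cc → ∃[ b ] value b ≡ cc
      value-onto cc with cc ≟ᵇ c₀
      ... | yes cc≡c₀ = false , sym cc≡c₀
      ... | no  cc≢c₀ = true , sym (¬-not cc≢c₀)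

      const : ∀ b → ComputesOn (leaf (value b)) g (Half b)
      const false = const₀
      const true  = const₁

      -- An input of the block on which g takes the value cc must lie in the half with constant cc.
      ¬¬witness : ∀ b cc → value b ≡ cc → ¬ ¬ Satisfiable (Half b)
      ¬¬witness b cc value-b≡cc = do
          (w , pw , gw≡cc) ← rankAtLeast⇒¬¬attains lb cc
          pure (w , pw , side w pw gw≡cc)
        where
          side : ∀ w → P w → g w ≡ cc → w j ≡ b
          side w pw gw≡cc with w j ≟ᵇ b
          ... | yes wj≡b = wj≡b
          ... | no  wj≢b = contradiction
                (trans (sym (agrees (const (not b)) w (pw , ¬-not wj≢b)))
                       (trans (value-not b) (cong not value-b≡cc)))
                (not-¬ gw≡cc)

      resolve : ∀ D b cc → value b ≡ cc → DepthAtLeast f (restrict (Forced π) i cc) (suc D) →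
                Satisfiable (Half b) → potential (suc (suc D)) ≤ r + score π
      resolve D b cc value-b≡cc dlb sat = begin
        suc (suc D) * c + 1                  ≡⟨ +-assoc c (suc D * c) 1 ⟩
        c + potential (suc D)                ≤⟨ +-monoʳ-≤ c ih′ ⟩
        c + (ρ + score π′)                   ≡⟨ trans (+-comm c _) (+-assoc ρ (score π′) c) ⟩
        ρ + (score π′ + c)                   ≡⟨ cong (ρ +_) score-fixed ⟩
        ρ + score π                          ≤⟨ +-monoˡ-≤ (score π) (rank-branch b T₀ T₁) ⟩
        r + score π                          ∎
        where
          open ≤-Reasoning
          ρ = rank (branch b T₀ T₁)
          v : Valid (Half b) (fixed cc)
          v = subst (λ v′ → ComputesOn (leaf v′) g (Half b)) value-b≡cc (const b) , sat
          B = narrow (π i) j b (fixed cc) v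
          π′ = π [ i ]≔ B
          forced⊆ : restrict (Forced π) i cc ⊆′ Forced π′
          forced⊆ _ (fy , yᵢ≡cc) = forced-update π i B fy yᵢ≡cc
          ih′ : potential (suc D) ≤ ρ + score π′
          ih′ = descend b _ v (suc D) (atLeast-mono forced⊆ dlb)
          score-fixed : score π′ + c ≡ score π
          score-fixed = begin-equality
            score π′ + c                      ≡⟨ cong (score π′ +_) pointsᵢ≡c ⟨
            score π′ + points (state (π i))   ≡⟨ score-update π i B ⟩
            score π + 0                       ≡⟨ +-identityʳ (score π) ⟩
            score π                           ∎

      fix : ∀ D → DepthAtLeast f (Forced π) D → ¬ ¬ (potential D ≤ r + score π)
      fix zero          _   = pure z≤n
      fix (suc zero)    _   = pure (begin
        1 * c + 1   ≡⟨ cong (_+ 1) (*-identityˡ c) ⟩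
        c + 1       ≡⟨ +-comm c 1 ⟩
        1 + c       ≤⟨ +-mono-≤ (rankCombine-positive (rank T₀) (rank T₁)) c≤score ⟩
        r + score π ∎)
        where
          open ≤-Reasoning
          c≤score : c ≤ score π
          c≤score = subst (_≤ score π) pointsᵢ≡c (xᵢ≤sum (points ∘ state ∘ π) i)
      fix (suc (suc D)) dlb = do
        (cc , dlb′) ← depthAtLeast-query dlb i
        let (b , value-b≡cc) = value-onto cc
        sat ← ¬¬witness b cc value-b≡cc
        pure (resolve D b cc value-b≡cc dlb′ sat)

    live-step : ∀ D → DepthAtLeast f (Forced π) D → ∀ spent left → state (π i) ≡ live spent left →
      spent + left ≡ c → RankAtLeast g P (suc left) →
      Dec (RankAtLeast g (Half false) (suc left)) → Dec (RankAtLeast g (Half true) (suc left)) →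
      ¬ ¬ (potential D ≤ r + score π)
    live-step D dlb spent left sᵢ≡ sum≡c lb (yes lb₀) _ =
      pure (keep D dlb false (subst (Valid (Half false)) (sym sᵢ≡) (sum≡c , lb₀)))
    live-step D dlb spent left sᵢ≡ sum≡c lb (no _) (yes lb₁) =
      pure (keep D dlb true (subst (Valid (Half true)) (sym sᵢ≡) (sum≡c , lb₁)))
    live-step D dlb spent zero sᵢ≡ sum≡c lb (no ¬lb₀) (no ¬lb₁) = do
        (c₀ , const₀) ← ¬rankAtLeast-1⇒¬¬constant ¬lb₀
        (c₁ , const₁) ← ¬rankAtLeast-1⇒¬¬constant ¬lb₁
        let c₁≡¬c₀ = ¬-not (constants-differ const₀ const₁)
        Fix.fix (trans (cong points sᵢ≡) (trans (sym (+-identityʳ spent)) sum≡c)) lb c₀ const₀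
                (subst (λ v → ComputesOn (leaf v) g (Half true)) c₁≡¬c₀ const₁) D dlb
      where
        constants-differ : ∀ {c₀ c₁} → ComputesOn (leaf c₀) g (Half false) →
                           ComputesOn (leaf c₁) g (Half true) → c₁ ≢ c₀
        constants-differ const₀ const₁ refl = n≮0 (lb (leaf _) (computesOn-split j const₀ const₁))
    live-step D dlb spent (suc left) sᵢ≡ sum≡c lb (no ¬lb₀) (no ¬lb₁) =
      pure (spend D dlb spent left (cong points sᵢ≡)
                  λ b → trans (sym (+-suc spent left)) sum≡c , rankAtLeast-restrict j b lb (¬other b))
      where
        ¬other : ∀ b → ¬ RankAtLeast g (Half (not b)) (suc (suc left))
        ¬other false = ¬lb₁
        ¬other true  = ¬lb₀

    step : ∀ D → DepthAtLeast f (Forced π) D → ∀ s → state (π i) ≡ s → Valid P s →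
           ¬ ¬ (potential D ≤ r + score π)
    step D dlb (fixed cc) sᵢ≡ (const , w , pw) =
      pure (keep D dlb (w j) (subst (Valid (Half (w j))) (sym sᵢ≡)
                                    (computesOn-mono (λ _ → proj₁) const , w , pw , refl)))
    step D dlb (live spent left) sᵢ≡ (sum≡c , lb) = do
      dec₀ ← ¬¬-excluded-middle
      dec₁ ← ¬¬-excluded-middle
      live-step D dlb spent left sᵢ≡ sum≡c lb dec₀ dec₁

  node-bound : ∀ i j {T₀ T₁} → (∀ b → PotentialBound (branch b T₀ T₁)) →
    PotentialBound (node (combine i j) T₀ T₁)
  node-bound i j ih π D dlb ok =
    decidable-stable (potential D ≤? _) (step D dlb (state (π i)) refl (valid (π i)))
    where open NodeStep i j ih π ok

  potential-bound : ∀ T → PotentialBound T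
  potential-bound (leaf b)       = leaf-bound b
  potential-bound (node v T₀ T₁) =
    subst (λ v → PotentialBound (node v T₀ T₁)) (combine-remQuot {n} m v)
          (node-bound (proj₁ (remQuot {n} m v)) (proj₂ (remQuot {n} m v)) children)
    where
      children : ∀ b → PotentialBound (branch b T₀ T₁)
      children false = potential-bound T₀
      children true  = potential-bound T₁

compose-rank-≥ : ∀ {n m} {f : BoolFun n} {g : BoolFun m} {D c} → Extensional f → Extensional g →
  (∀ t → Computes t f → suc D ≤ depth t) → (∀ t → Computes t g → suc c ≤ rank t) →
  ∀ t → Computes t (compose f g) → suc D * c + 1 ≤ rank t
compose-rank-≥ {n} {m} {f} {g} {D} {c} f-ext g-ext depth-f rank-g t ok =
  subst (suc D * c + 1 ≤_) rank+0
        (potential-bound t start (suc D) (λ t′ ok′ → depth-f t′ λ y → agrees ok′ y λ _ → tt)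
                         (computesOn λ a _ → ok a))
  where
    open Adversary f-ext g-ext c
    start : Position
    start _ = record { inputs = U ; respects = λ _ _ → tt ; state = live 0 c
                     ; valid = refl , λ t′ ok′ → rank-g t′ λ w → agrees ok′ w tt }
    rank+0 : rank t + score start ≡ rank t
    rank+0 = trans (cong (rank t +_) (sum-replicate-zero n)) (+-identityʳ (rank t))

iter-rank-≥ : ∀ {n} {f : BoolFun n} {d r} → Extensional f →
  (∀ t → Computes t f → suc d ≤ depth t) → (∀ t → Computes t f → suc r ≤ rank t) →
  ∀ k t → Computes t (iter f (suc k)) → suc d ^ k * r + 1 ≤ rank t
iter-rank-≥ {n} {f} {d} {r} f-ext depth-f rank-f zero t ok = begin
  1 * r + 1                 ≡⟨ cong (_+ 1) (*-identityˡ r) ⟩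
  r + 1                     ≡⟨ +-comm r 1 ⟩
  suc r                     ≤⟨ rank-f (relabel quotient t) ok′ ⟩
  rank (relabel quotient t) ≡⟨ rank-relabel quotient t ⟩
  rank t                    ∎
  where
    open ≤-Reasoning
    quotient : Fin (n * 1) → Fin n
    quotient v = proj₁ (remQuot {n} 1 v)
    ok′ : Computes (relabel quotient t) f
    ok′ x = trans (eval-relabel quotient t x)
                  (trans (ok (x ∘ quotient)) (f-ext λ i → cong (x ∘ proj₁) (remQuot-combine i fzero)))
iter-rank-≥ {f = f} {d} {r} f-ext depth-f rank-f (suc k) t ok =
  subst (_≤ rank t) (cong (_+ 1) (sym (*-assoc (suc d) (suc d ^ k) r)))
        (compose-rank-≥ f-ext (iter-extensional f-ext (suc k)) depth-f rank-iter t ok)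
  where
    rank-iter : ∀ t′ → Computes t′ (iter f (suc k)) → suc (suc d ^ k * r) ≤ rank t′
    rank-iter t′ ok′ = subst (_≤ rank t′) (+-comm _ 1) (iter-rank-≥ f-ext depth-f rank-f k t′ ok′)

corollary6p8 : ∀ {n : ℕ} (f : BoolFun n) (k : ℕ) (d r R : ℕ) →
    1 ≤ k → NonConstant f →
    IsDepth f d → IsRank f r → IsRank (iter f k) R →
    ((d ^ (k ∸ 1)) * (r ∸ 1) + 1 ≤ R) × (R ≤ (d ^ (k ∸ 1)) * r)
corollary6p8 f zero _ _ _ () _ _ _ _
corollary6p8 f (suc k) zero _ _ _ nc ((t , ok , depth≡0) , _) _ _ =
  ⊥-elim (n≮0 (subst (0 <_) depth≡0 (nonConstant⇒depth-positive nc t ok)))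
corollary6p8 f (suc k) (suc d) zero _ _ nc _ ((t , ok , rank≡0) , _) _ =
  ⊥-elim (n≮0 (subst (0 <_) rank≡0 (nonConstant⇒rank-positive nc t ok)))
corollary6p8 f (suc k) (suc d) (suc r) R _ _
  ((tᵈ , okᵈ , depth≡) , min-depth) ((tʳ , okʳ , rank≡) , min-rank) ((t , ok , rank≡R) , min-rank-iter) =
  subst (_ ≤_) rank≡R (iter-rank-≥ (computes⇒extensional tᵈ okᵈ) min-depth min-rank k t ok) ,
  ≤-trans (min-rank-iter t′ ok′) (subst₂ (λ d′ r′ → rank t′ ≤ d′ ^ k * r′) depth≡ rank≡ t′≤)
  where
    upper = iter-rank-≤ tᵈ tʳ okᵈ okʳ k
    t′ = proj₁ upper
    ok′ = proj₁ (proj₂ upper)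
    t′≤ = proj₂ (proj₂ upper)
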